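{- For all $k\in2\mathbb{Z}$, $h\in\mathbb{Z}$ and $u\in\mathbb{Z}_{\ge0}$: (i) $\mathcal{A}^k_h(u)\in\mathbb{Z}$; (ii) $\mathcal{A}^k_{1-h}(u)=\mathcal{A}^k_h(u)$; (iii) $\mathcal{A}^k_h(u)=\frac{(-1)^{k/2}}{u!}\prod_{\ell=k/2+1-u}^{\max(0,k/2)}\left[(h-1/2)^2-(\ell-1/2)^2\right]$, where an empty product (which occurs when $u=0$ and $k\ge0$) equals $1$, so $\mathcal{A}^k_h(0)=(-1)^{k/2}$ for $k\ge0$; (iv) if $h^*<k/2$ then $\mathcal{A}^k_h(u)\neq0$ if and only if $0\le u\le k/2-1-h^*$; (v) if $h^*\ge k/2$ then $\mathcal{A}^k_h(u)\neq0$ if and only if $0\le u\le k/2+h^*$.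
   Context: For $h\in\mathbb{Z}$, $h^*=h-1$ if $h\ge1$ and $h^*=-h$ if $h\le0$. Generalized binomial coefficients: $\binom{z}{n}=z(z-1)\cdots(z-n+1)/n!$ for $n\in\mathbb{Z}_{\ge0}$ and $0$ for $n<0$. $\mathcal{A}^k_h(u)=(-1)^{u+k/2}u!\binom{k/2+h-1}{u}\binom{k/2-h}{u}$ if $k\ge0$, and $\mathcal{A}^k_h(u)=(-1)^u\frac{[(u-k/2)!]^2}{u!}\binom{h-1}{u-k/2}\binom{ -h}{u-k/2}$ if $k\le0$. -}

module Defs where

open import Data.Nat as ℕ using (ℕ; zero; suc; _!)
open import Data.Nat.Properties using (_!≢0)
open import Data.Integer as ℤ using (ℤ; +_; -[1+_]; ∣_∣; _⊔_)
open import Data.Rational using (ℚ; _/_; 1ℚ; ½; _*_; _-_; -_)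

-- k / 2 (integer division; used only for even k, where it is exact)
half : ℤ → ℤ
half k = k ℤ./ + 2

toℚ : ℤ → ℚ
toℚ z = z / 1

signPow : ℤ → ℚ
signPow z with ∣ z ∣ ℕ.% 2
... | zero = 1ℚ
... | suc _ = - 1ℚ

fact : ℕ → ℚ
fact n = + (n !) / 1

invFact : ℕ → ℚ
invFact n = (+ 1 / (n !)) {{n !≢0}}

falling : ℤ → ℕ → ℤ
falling z zero = + 1
falling z (suc n) = falling z n ℤ.* (z ℤ.- + n)

binom : ℤ → ℕ → ℚ
binom z n = (falling z n / (n !)) {{n !≢0}}

hstar : ℤ → ℤ
hstar (+ zero) = + 0
hstar (+ suc n) = + n
hstar -[1+ n ] = + suc n

-- 𝒜^k_h(u); case k ≥ 0 is k = + n, case k < 0 is k = -[1+ n]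
-- (at k = 0 both formulas of the paper coincide)
A : ℤ → ℤ → ℕ → ℚ
A (+ n) h u =
  signPow (+ u ℤ.+ half (+ n)) * fact u
    * binom (half (+ n) ℤ.+ h ℤ.- + 1) u * binom (half (+ n) ℤ.- h) u
A k@(-[1+ n ]) h u =
  signPow (+ u) * ((fact j * fact j) * invFact u)
    * binom (h ℤ.- + 1) j * binom (ℤ.- h) j
  where
  -- j = u - k/2 ≥ 0
  j : ℕ
  j = u ℕ.+ ∣ half k ∣

count : ℤ → ℤ → ℕ
count a b with b ℤ.- a ℤ.+ + 1
... | + m = m
... | -[1+ _ ] = 0

prodN : ℕ → (ℕ → ℚ) → ℚ
prodN zero f = 1ℚ
prodN (suc n) f = prodN n f * f n

prodRange : ℤ → ℤ → (ℤ → ℚ) → ℚ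
prodRange a b f = prodN (count a b) (λ i → f (a ℤ.+ + i))

factorTerm : ℤ → ℤ → ℚ
factorTerm h ℓ =
  (toℚ h - ½) * (toℚ h - ½) - (toℚ ℓ - ½) * (toℚ ℓ - ½)

{-# OPTIONS --safe #-}
-- Writing (x)ₙ for the falling factorial, the definition of 𝒜 reads
--   𝒜 = (-1)^(u+q) (q+h-1)ᵤ (q-h)ᵤ / u!                 for k = 2q ≥ 0,
--   𝒜 = (-1)^u (h-1)ⱼ (-h)ⱼ / u!   with j = u+q+1       for k = -2(q+1) < 0.
-- Since (h-½)² - (ℓ-½)² = (h-ℓ)(h+ℓ-1), the product over c+1-j ≤ ℓ ≤ c equals
-- (-1)^j (c-h)ⱼ (c+h-1)ⱼ; taking (c, j) = (q, u), resp. (0, u+q+1), gives (iii), and the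
-- invariance of each factor under h ↦ 1-h gives (ii). As n! divides (x)ₙ for every integer x
-- (Pascal's rule, inducting on x in both directions) and u! ∣ j!, (i) follows. Finally
-- (x)ₙ = 0 exactly when 0 ≤ x < n; by (ii) we may take h ≥ 1, so that h* = h-1, and (iv),
-- (v) say when both falling factorials are nonzero.
module Submission where

open import Defs
open import Data.Nat using (ℕ)
open import Data.Integer using (ℤ; +_; _+_; _-_; _≤_; _<_; _⊔_)
open import Data.Integer.Divisibility using (_∣_)
open import Data.Rational using (ℚ; _/_; _*_; 0ℚ)
open import Data.Product using (_×_; ∃)
open import Function.Bundles using (_⇔_)
open import Relation.Binary.PropositionalEquality using (_≡_; _≢_)

open import Data.Nat as ℕ using (zero; suc; _!; s≤s)
import Data.Nat.Properties as ℕ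
open import Data.Nat.DivMod using (m*n/n≡m; m*n%n≡0)
open import Data.Nat.Divisibility using (divides; m≤n⇒m!∣n!)
open import Data.Integer as ℤ using (-[1+_]; 0ℤ; 1ℤ; -1ℤ; _^_; ∣_∣; +≤+; -<+)
import Data.Integer.Properties as ℤ
import Data.Integer.Divisibility.Signed as Signed
open import Data.Integer.Tactic.RingSolver using (solve-∀)
open import Data.Rational as ℚ using (1ℚ; ½; fromℚᵘ; toℚᵘ)
import Data.Rational.Properties as ℚ
import Data.Rational.Unnormalised as ℚᵘ
import Data.Rational.Unnormalised.Properties as ℚᵘ
open import Data.Rational.Solver using (module +-*-Solver)
open import Data.Product using (_,_; proj₁; proj₂)
open import Data.Sum using (inj₁; inj₂; [_,_]′)
open import Data.Empty using (⊥-elim)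
open import Function.Bundles using (mk⇔; module Equivalence)
open import Function.Construct.Composition using (_⇔-∘_)
open import Relation.Binary.PropositionalEquality
  using (refl; sym; trans; cong; cong₂; subst; module ≡-Reasoning)

open Equivalence using (to; from)

fromℚᵘ-homo-* : ∀ p q → fromℚᵘ (p ℚᵘ.* q) ≡ fromℚᵘ p * fromℚᵘ q
fromℚᵘ-homo-* p q = ℚ.toℚᵘ-injective (begin
  toℚᵘ (fromℚᵘ (p ℚᵘ.* q))               ≈⟨ ℚ.toℚᵘ-fromℚᵘ (p ℚᵘ.* q) ⟩
  p ℚᵘ.* q                               ≈⟨ ℚᵘ.*-cong (ℚ.toℚᵘ-fromℚᵘ p) (ℚ.toℚᵘ-fromℚᵘ q) ⟨
  toℚᵘ (fromℚᵘ p) ℚᵘ.* toℚᵘ (fromℚᵘ q)   ≈⟨ ℚ.toℚᵘ-homo-* (fromℚᵘ p) (fromℚᵘ q) ⟨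
  toℚᵘ (fromℚᵘ p * fromℚᵘ q)             ∎)
  where open ℚᵘ.≃-Reasoning

fromℚᵘ-homo-+ : ∀ p q → fromℚᵘ (p ℚᵘ.+ q) ≡ fromℚᵘ p ℚ.+ fromℚᵘ q
fromℚᵘ-homo-+ p q = ℚ.toℚᵘ-injective (begin
  toℚᵘ (fromℚᵘ (p ℚᵘ.+ q))               ≈⟨ ℚ.toℚᵘ-fromℚᵘ (p ℚᵘ.+ q) ⟩
  p ℚᵘ.+ q                               ≈⟨ ℚᵘ.+-cong (ℚ.toℚᵘ-fromℚᵘ p) (ℚ.toℚᵘ-fromℚᵘ q) ⟨
  toℚᵘ (fromℚᵘ p) ℚᵘ.+ toℚᵘ (fromℚᵘ q)   ≈⟨ ℚ.toℚᵘ-homo-+ (fromℚᵘ p) (fromℚᵘ q) ⟨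
  toℚᵘ (fromℚᵘ p ℚ.+ fromℚᵘ q)           ∎)
  where open ℚᵘ.≃-Reasoning

fromℚᵘ-homo‿- : ∀ p → fromℚᵘ (ℚᵘ.- p) ≡ ℚ.- fromℚᵘ p
fromℚᵘ-homo‿- p = ℚ.toℚᵘ-injective (begin
  toℚᵘ (fromℚᵘ (ℚᵘ.- p))      ≈⟨ ℚ.toℚᵘ-fromℚᵘ (ℚᵘ.- p) ⟩
  ℚᵘ.- p                      ≈⟨ ℚᵘ.-‿cong (ℚ.toℚᵘ-fromℚᵘ p) ⟨
  ℚᵘ.- toℚᵘ (fromℚᵘ p)        ≈⟨ ℚ.toℚᵘ-homo‿- (fromℚᵘ p) ⟨
  toℚᵘ (ℚ.- fromℚᵘ p)         ∎)
  where open ℚᵘ.≃-Reasoning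

toℚ-homo-* : ∀ a b → toℚ (a ℤ.* b) ≡ toℚ a * toℚ b
toℚ-homo-* a b = fromℚᵘ-homo-* (ℚᵘ.mkℚᵘ a 0) (ℚᵘ.mkℚᵘ b 0)

toℚ-homo-+ : ∀ a b → toℚ (a ℤ.+ b) ≡ toℚ a ℚ.+ toℚ b
toℚ-homo-+ a b = trans
  (ℚ.fromℚᵘ-cong {ℚᵘ.mkℚᵘ (a ℤ.+ b) 0} {ℚᵘ.mkℚᵘ a 0 ℚᵘ.+ ℚᵘ.mkℚᵘ b 0}
    (ℚᵘ.*≡* (lemma a b)))
  (fromℚᵘ-homo-+ (ℚᵘ.mkℚᵘ a 0) (ℚᵘ.mkℚᵘ b 0))
  where
  lemma : ∀ a b → (a ℤ.+ b) ℤ.* + 1 ≡ (a ℤ.* + 1 ℤ.+ b ℤ.* + 1) ℤ.* + 1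
  lemma = solve-∀

toℚ-homo-- : ∀ a b → toℚ (a - b) ≡ toℚ a ℚ.- toℚ b
toℚ-homo-- a b =
  trans (toℚ-homo-+ a (ℤ.- b)) (cong (toℚ a ℚ.+_) (fromℚᵘ-homo‿- (ℚᵘ.mkℚᵘ b 0)))

toℚ-injective : ∀ {a b} → toℚ a ≡ toℚ b → a ≡ b
toℚ-injective {a} {b} eq with ℚ.fromℚᵘ-injective {ℚᵘ.mkℚᵘ a 0} {ℚᵘ.mkℚᵘ b 0} eq
... | ℚᵘ.*≡* a*1≡b*1 = trans (sym (ℤ.*-identityʳ a)) (trans a*1≡b*1 (ℤ.*-identityʳ b))

/-as-* : ∀ z d .{{_ : ℕ.NonZero d}} → z / d ≡ toℚ z * (+ 1 / d)
/-as-* z (suc d) = trans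
  (ℚ.fromℚᵘ-cong {ℚᵘ.mkℚᵘ z d} {ℚᵘ.mkℚᵘ z 0 ℚᵘ.* ℚᵘ.mkℚᵘ (+ 1) d}
    (ℚᵘ.*≡* (cong₂ ℤ._*_ (sym (ℤ.*-identityʳ z)) (cong (λ n → + suc n) (ℕ.+-identityʳ d)))))
  (fromℚᵘ-homo-* (ℚᵘ.mkℚᵘ z 0) (ℚᵘ.mkℚᵘ (+ 1) d))

*-1/-inverse : ∀ d .{{_ : ℕ.NonZero d}} → toℚ (+ d) * (+ 1 / d) ≡ 1ℚ
*-1/-inverse (suc d) = trans
  (sym (fromℚᵘ-homo-* (ℚᵘ.mkℚᵘ (+ suc d) 0) (ℚᵘ.mkℚᵘ (+ 1) d)))
  (ℚ.fromℚᵘ-cong {ℚᵘ.mkℚᵘ (+ suc d) 0 ℚᵘ.* ℚᵘ.mkℚᵘ (+ 1) d} {ℚᵘ.mkℚᵘ (+ 1) 0}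
    (ℚᵘ.*≡* (trans (ℤ.*-identityʳ _) (trans (ℤ.*-identityʳ _)
      (sym (trans (ℤ.*-identityˡ _) (cong (λ n → + suc n) (ℕ.+-identityʳ d))))))))

toℚ-homo-*₃ : ∀ a b c → toℚ (a ℤ.* (b ℤ.* c)) ≡ toℚ a * (toℚ b * toℚ c)
toℚ-homo-*₃ a b c = trans (toℚ-homo-* a (b ℤ.* c)) (cong (toℚ a *_) (toℚ-homo-* b c))

binom≡ : ∀ z n → binom z n ≡ toℚ (falling z n) * invFact n
binom≡ z n = /-as-* (falling z n) (n !) {{n ℕ.!≢0}}

fact*invFact≡1 : ∀ n → fact n * invFact n ≡ 1ℚ
fact*invFact≡1 n = *-1/-inverse (n !) {{n ℕ.!≢0}}

toℚ-*-invFact-≡0 : ∀ M u → toℚ M * invFact u ≡ 0ℚ → M ≡ 0ℤ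
toℚ-*-invFact-≡0 M u eq = toℚ-injective (begin
  toℚ M                          ≡⟨ ℚ.*-identityʳ (toℚ M) ⟨
  toℚ M * 1ℚ                     ≡⟨ cong (toℚ M *_) (trans (ℚ.*-comm (invFact u) (fact u)) (fact*invFact≡1 u)) ⟨
  toℚ M * (invFact u * fact u)   ≡⟨ ℚ.*-assoc (toℚ M) (invFact u) (fact u) ⟨
  toℚ M * invFact u * fact u     ≡⟨ cong (_* fact u) eq ⟩
  0ℚ * fact u                    ≡⟨ ℚ.*-zeroˡ (fact u) ⟩
  0ℚ                             ∎)
  where open ≡-Reasoning

-1^[2+n] : ∀ n → -1ℤ ^ suc (suc n) ≡ -1ℤ ^ n
-1^[2+n] n = lemma (-1ℤ ^ n)
  where
  lemma : ∀ x → -1ℤ ℤ.* (-1ℤ ℤ.* x) ≡ x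
  lemma = solve-∀

signPow-+ : ∀ n → signPow (+ n) ≡ toℚ (-1ℤ ^ n)
signPow-+ zero = refl
signPow-+ (suc zero) = refl
signPow-+ (suc (suc n)) = trans (signPow-+ n) (cong toℚ (sym (-1^[2+n] n)))

signPow≡ : ∀ z → signPow z ≡ toℚ (-1ℤ ^ ∣ z ∣)
signPow≡ (+ n) = signPow-+ n
signPow≡ -[1+ n ] = signPow-+ (suc n)

-1^n≢0 : ∀ n → -1ℤ ^ n ≢ 0ℤ
-1^n≢0 n eq with ℤ.i^n≡0⇒i≡0 -1ℤ n eq
... | ()

-1^n*-1^n≡1 : ∀ n → -1ℤ ^ n ℤ.* -1ℤ ^ n ≡ 1ℤ
-1^n*-1^n≡1 zero = refl
-1^n*-1^n≡1 (suc n) = trans (lemma (-1ℤ ^ n)) (-1^n*-1^n≡1 n)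
  where
  lemma : ∀ x → -1ℤ ℤ.* x ℤ.* (-1ℤ ℤ.* x) ≡ x ℤ.* x
  lemma = solve-∀

signPow-scaled : ∀ t u N →
  signPow t * invFact u * toℚ N ≡ toℚ (-1ℤ ^ ∣ t ∣ ℤ.* N) * invFact u
signPow-scaled t u N = begin
  signPow t * invFact u * toℚ N
    ≡⟨ cong (λ s → s * invFact u * toℚ N) (signPow≡ t) ⟩
  toℚ (-1ℤ ^ ∣ t ∣) * invFact u * toℚ N
    ≡⟨ solve 3 (λ s i n → s :* i :* n := s :* n :* i) refl (toℚ (-1ℤ ^ ∣ t ∣)) (invFact u) (toℚ N) ⟩
  toℚ (-1ℤ ^ ∣ t ∣) * toℚ N * invFact u
    ≡⟨ cong (_* invFact u) (toℚ-homo-* (-1ℤ ^ ∣ t ∣) N) ⟨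
  toℚ (-1ℤ ^ ∣ t ∣ ℤ.* N) * invFact u ∎
  where
  open ≡-Reasoning
  open +-*-Solver

*-≢0⇔ : ∀ i j → (i ℤ.* j ≢ 0ℤ) ⇔ (i ≢ 0ℤ × j ≢ 0ℤ)
*-≢0⇔ i j = mk⇔
  (λ ij≢0 → (λ i≡0 → ij≢0 (trans (cong (ℤ._* j) i≡0) (ℤ.*-zeroˡ j)))
          , (λ j≡0 → ij≢0 (trans (cong (i ℤ.*_) j≡0) (ℤ.*-zeroʳ i))))
  (λ { (i≢0 , j≢0) ij≡0 → [ i≢0 , j≢0 ]′ (ℤ.i*j≡0⇒i≡0∨j≡0 i ij≡0) })

+-≤⇔≤- : ∀ i j k → (i + j ≤ k) ⇔ (i ≤ k - j)
+-≤⇔≤- i j k = mk⇔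
  (λ i+j≤k → subst (_≤ k - j) (lemma₁ i j) (ℤ.+-monoˡ-≤ (ℤ.- j) i+j≤k))
  (λ i≤k-j → subst (i + j ≤_) (lemma₂ k j) (ℤ.+-monoˡ-≤ j i≤k-j))
  where
  lemma₁ : ∀ i j → i + j - j ≡ i
  lemma₁ = solve-∀
  lemma₂ : ∀ k j → k - j + j ≡ k
  lemma₂ = solve-∀

+0≤+u×-⇔ : ∀ {P : Set} {u z} → P ⇔ (+ u ≤ z) → P ⇔ (+ 0 ≤ + u × + u ≤ z)
+0≤+u×-⇔ P⇔ = mk⇔ (λ p → +≤+ ℕ.z≤n , to P⇔ p) (λ u≤z → from P⇔ (proj₂ u≤z))

-- Falling factorials

falling-suc : ∀ z n → falling z (suc n) ≡ z ℤ.* falling (z - + 1) n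
falling-suc z zero = lemma z
  where
  lemma : ∀ z → + 1 ℤ.* (z - + 0) ≡ z ℤ.* + 1
  lemma = solve-∀
falling-suc z (suc n) = trans (cong (ℤ._* (z - + suc n)) (falling-suc z n)) (lemma z (falling (z - + 1) n) (+ n))
  where
  lemma : ∀ z x n → z ℤ.* x ℤ.* (z - (+ 1 + n)) ≡ z ℤ.* (x ℤ.* (z - + 1 - n))
  lemma = solve-∀

falling-pascal : ∀ z n → falling (+ 1 + z) (suc n) ≡ falling z (suc n) + + suc n ℤ.* falling z n
falling-pascal z n = begin
  falling (+ 1 + z) (suc n)                    ≡⟨ falling-suc (+ 1 + z) n ⟩
  (+ 1 + z) ℤ.* falling (+ 1 + z - + 1) n      ≡⟨ cong (λ y → (+ 1 + z) ℤ.* falling y n) (lemma₁ z) ⟩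
  (+ 1 + z) ℤ.* falling z n                    ≡⟨ lemma₂ z (falling z n) (+ n) ⟩
  falling z n ℤ.* (z - + n) + + suc n ℤ.* falling z n ∎
  where
  open ≡-Reasoning
  lemma₁ : ∀ z → + 1 + z - + 1 ≡ z
  lemma₁ = solve-∀
  lemma₂ : ∀ z x n → (+ 1 + z) ℤ.* x ≡ x ℤ.* (z - n) + (+ 1 + n) ℤ.* x
  lemma₂ = solve-∀

falling-≡0 : ∀ {n u} → n ℕ.< u → falling (+ n) u ≡ 0ℤ
falling-≡0 {n} {suc u} (s≤s n≤u) with ℕ.m≤n⇒m<n∨m≡n n≤u
... | inj₁ n<u = cong (ℤ._* (+ n - + u)) (falling-≡0 n<u)
... | inj₂ refl = trans (cong (falling (+ n) n ℤ.*_) (ℤ.+-inverseʳ (+ n))) (ℤ.*-zeroʳ (falling (+ n) n))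

n!∣falling : ∀ n z → + (n !) Signed.∣ falling z n
n!∣falling zero z = Signed.∣-refl
n!∣falling (suc n) = go
  where
  [n+1]!∣step : ∀ z → + (suc n !) Signed.∣ + suc n ℤ.* falling z n
  [n+1]!∣step z = subst (Signed._∣ + suc n ℤ.* falling z n) (sym (ℤ.pos-* (suc n) (n !)))
    (Signed.*-monoʳ-∣ (+ suc n) (n!∣falling n z))
  up : ∀ z → + (suc n !) Signed.∣ falling z (suc n) → + (suc n !) Signed.∣ falling (+ 1 + z) (suc n)
  up z d = subst (+ (suc n !) Signed.∣_) (sym (falling-pascal z n)) (Signed.∣m∣n⇒∣m+n d ([n+1]!∣step z))
  down : ∀ z → + (suc n !) Signed.∣ falling (+ 1 + z) (suc n) → + (suc n !) Signed.∣ falling z (suc n)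
  down z d = Signed.∣m+n∣n⇒∣m (subst (+ (suc n !) Signed.∣_) (falling-pascal z n) d) ([n+1]!∣step z)
  go : ∀ z → + (suc n !) Signed.∣ falling z (suc n)
  go (+ zero) = Signed.divides 0ℤ (trans (falling-≡0 {0} {suc n} (s≤s ℕ.z≤n)) (sym (ℤ.*-zeroˡ (+ (suc n !)))))
  go (+ suc m) = up (+ m) (go (+ m))
  go -[1+ zero ] = down -[1+ zero ] (go (+ zero))
  go -[1+ suc m ] = down -[1+ suc m ] (go -[1+ m ])

falling-≢0 : ∀ {n u} → u ℕ.≤ n → falling (+ n) u ≢ 0ℤ
falling-≢0 {u = zero} _ ()
falling-≢0 {n} {suc u} u<n eq with ℤ.i*j≡0⇒i≡0∨j≡0 (falling (+ n) u) eq
... | inj₁ e = falling-≢0 (ℕ.<⇒≤ u<n) e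
... | inj₂ e = ℕ.<⇒≢ u<n (sym (ℤ.+-injective (ℤ.i-j≡0⇒i≡j (+ n) (+ u) e)))

falling-nonneg-≢0⇔ : ∀ {z} u → 0ℤ ≤ z → (falling z u ≢ 0ℤ) ⇔ (+ u ≤ z)
falling-nonneg-≢0⇔ {+ n} u _ = mk⇔
  (λ ≢0 → +≤+ ([ (λ u≤n → u≤n) , (λ n<u → ⊥-elim (≢0 (falling-≡0 n<u))) ]′ (ℕ.≤-<-connex u n)))
  (λ { (+≤+ u≤n) → falling-≢0 u≤n })

falling-neg-≢0 : ∀ {z} u → z < 0ℤ → falling z u ≢ 0ℤ
falling-neg-≢0 zero _ ()
falling-neg-≢0 {z = -[1+ n ]} (suc u) -<+ eq with ℤ.i*j≡0⇒i≡0∨j≡0 (falling -[1+ n ] u) eq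
... | inj₁ e = falling-neg-≢0 u -<+ e
... | inj₂ e = last-factor u e
  where
  last-factor : ∀ u → -[1+ n ] - + u ≢ 0ℤ
  last-factor zero ()
  last-factor (suc u) ()

-- The product in (iii)

factorTerm≡ : ∀ h ℓ → factorTerm h ℓ ≡ toℚ ((h - ℓ) ℤ.* (h + ℓ - + 1))
factorTerm≡ h ℓ = sym (begin
  toℚ ((h - ℓ) ℤ.* (h + ℓ - + 1))
    ≡⟨ toℚ-homo-* (h - ℓ) (h + ℓ - + 1) ⟩
  toℚ (h - ℓ) * toℚ (h + ℓ - + 1)
    ≡⟨ cong₂ _*_ (toℚ-homo-- h ℓ) (trans (toℚ-homo-- (h + ℓ) (+ 1)) (cong (ℚ._- 1ℚ) (toℚ-homo-+ h ℓ))) ⟩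
  (toℚ h ℚ.- toℚ ℓ) * (toℚ h ℚ.+ toℚ ℓ ℚ.- (½ ℚ.+ ½))
    ≡⟨ solve 3 (λ x y t → (x :- y) :* (x :+ y :- (t :+ t)) := (x :- t) :* (x :- t) :- (y :- t) :* (y :- t))
         refl (toℚ h) (toℚ ℓ) ½ ⟩
  factorTerm h ℓ ∎)
  where
  open ≡-Reasoning
  open +-*-Solver

factorTerm-reflect : ∀ h ℓ → factorTerm (+ 1 - h) ℓ ≡ factorTerm h ℓ
factorTerm-reflect h ℓ = trans (factorTerm≡ (+ 1 - h) ℓ) (trans (cong toℚ (lemma h ℓ)) (sym (factorTerm≡ h ℓ)))
  where
  lemma : ∀ h ℓ → (+ 1 - h - ℓ) ℤ.* (+ 1 - h + ℓ - + 1) ≡ (h - ℓ) ℤ.* (h + ℓ - + 1)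
  lemma = solve-∀

prodN-cong : ∀ n {f g : ℕ → ℚ} → (∀ i → f i ≡ g i) → prodN n f ≡ prodN n g
prodN-cong zero f≗g = refl
prodN-cong (suc n) f≗g = cong₂ _*_ (prodN-cong n f≗g) (f≗g n)

prodRange-factorTerm-reflect : ∀ h a b → prodRange a b (factorTerm (+ 1 - h)) ≡ prodRange a b (factorTerm h)
prodRange-factorTerm-reflect h a b = prodN-cong (count a b) (λ i → factorTerm-reflect h (a + + i))

fallingProduct : ℤ → ℤ → ℕ → ℤ
fallingProduct h c j = -1ℤ ^ j ℤ.* (falling (c - h) j ℤ.* falling (c + h - + 1) j)

fallingProduct-suc : ∀ h c j →
  fallingProduct h c (suc j) ≡ fallingProduct h (c - + 1) j ℤ.* ((h - c) ℤ.* (h + c - + 1))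
fallingProduct-suc h c j = begin
  -1ℤ ^ suc j ℤ.* (falling (c - h) (suc j) ℤ.* falling (c + h - + 1) (suc j))
    ≡⟨ cong (-1ℤ ^ suc j ℤ.*_) (cong₂ ℤ._*_ (falling-suc (c - h) j) (falling-suc (c + h - + 1) j)) ⟩
  -1ℤ ^ suc j ℤ.* ((c - h) ℤ.* falling (c - h - + 1) j ℤ.* ((c + h - + 1) ℤ.* falling (c + h - + 1 - + 1) j))
    ≡⟨ lemma₁ (-1ℤ ^ j) (falling (c - h - + 1) j) (falling (c + h - + 1 - + 1) j) h c ⟩
  -1ℤ ^ j ℤ.* (falling (c - h - + 1) j ℤ.* falling (c + h - + 1 - + 1) j) ℤ.* ((h - c) ℤ.* (h + c - + 1))
    ≡⟨ cong (λ x → -1ℤ ^ j ℤ.* x ℤ.* ((h - c) ℤ.* (h + c - + 1)))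
         (cong₂ ℤ._*_ (cong (λ y → falling y j) (lemma₂ h c)) (cong (λ y → falling y j) (lemma₃ h c))) ⟩
  fallingProduct h (c - + 1) j ℤ.* ((h - c) ℤ.* (h + c - + 1)) ∎
  where
  open ≡-Reasoning
  lemma₁ : ∀ s x y h c → -1ℤ ℤ.* s ℤ.* ((c - h) ℤ.* x ℤ.* ((c + h - + 1) ℤ.* y))
                       ≡ s ℤ.* (x ℤ.* y) ℤ.* ((h - c) ℤ.* (h + c - + 1))
  lemma₁ = solve-∀
  lemma₂ : ∀ h c → c - h - + 1 ≡ c - + 1 - h
  lemma₂ = solve-∀
  lemma₃ : ∀ h c → c + h - + 1 - + 1 ≡ c - + 1 + h - + 1
  lemma₃ = solve-∀

prodN-factorTerm : ∀ h c j → prodN j (λ i → factorTerm h (c + + 1 - + j + + i)) ≡ toℚ (fallingProduct h c j)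
prodN-factorTerm h c zero = refl
prodN-factorTerm h c (suc j) = begin
  prodN j (λ i → factorTerm h (c + + 1 - + suc j + + i)) * factorTerm h (c + + 1 - + suc j + + j)
    ≡⟨ cong₂ _*_ (prodN-cong j (λ i → cong (factorTerm h) (lemma₁ c (+ j) (+ i))))
                 (cong (factorTerm h) (lemma₂ c (+ j))) ⟩
  prodN j (λ i → factorTerm h (c - + 1 + + 1 - + j + + i)) * factorTerm h c
    ≡⟨ cong₂ _*_ (prodN-factorTerm h (c - + 1) j) (factorTerm≡ h c) ⟩
  toℚ (fallingProduct h (c - + 1) j) * toℚ ((h - c) ℤ.* (h + c - + 1))
    ≡⟨ toℚ-homo-* (fallingProduct h (c - + 1) j) _ ⟨
  toℚ (fallingProduct h (c - + 1) j ℤ.* ((h - c) ℤ.* (h + c - + 1)))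
    ≡⟨ cong toℚ (fallingProduct-suc h c j) ⟨
  toℚ (fallingProduct h c (suc j)) ∎
  where
  open ≡-Reasoning
  lemma₁ : ∀ c j i → c + + 1 - (+ 1 + j) + i ≡ c - + 1 + + 1 - j + i
  lemma₁ = solve-∀
  lemma₂ : ∀ c j → c + + 1 - (+ 1 + j) + j ≡ c
  lemma₂ = solve-∀

count≡ : ∀ a b j → b - a + + 1 ≡ + j → count a b ≡ j
count≡ a b j eq rewrite eq = refl

prodRange-factorTerm : ∀ h c j → prodRange (c + + 1 - + j) c (factorTerm h) ≡ toℚ (fallingProduct h c j)
prodRange-factorTerm h c j =
  trans (cong (λ n → prodN n (λ i → factorTerm h (c + + 1 - + j + + i))) (count≡ _ c j (lemma c (+ j))))
        (prodN-factorTerm h c j)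
  where
  lemma : ∀ c j → c - (c + + 1 - j) + + 1 ≡ j
  lemma = solve-∀

-- 𝒜 as a product

half-nonneg : ∀ q → half (+ (q ℕ.* 2)) ≡ + q
half-nonneg q = trans (ℤ.*-identityˡ _) (cong +_ (m*n/n≡m q 2))

half-neg : ∀ q → half -[1+ suc (q ℕ.* 2) ] ≡ -[1+ q ]
half-neg q = trans (ℤ.*-identityˡ _)
  (trans (divide-exact (suc (q ℕ.* 2)) (m*n%n≡0 (suc q) 2)) (cong (λ n → ℤ.- (+ n)) (m*n/n≡m (suc q) 2)))
  where
  divide-exact : ∀ n → suc n ℕ.% 2 ≡ 0 → -[1+ n ] ℤ./ℕ 2 ≡ ℤ.- (+ (suc n ℕ./ 2))
  divide-exact n eq with suc n ℕ.% 2 | eq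
  ... | .0 | refl = refl

A-nonneg : ∀ q h u → A (+ (q ℕ.* 2)) h u ≡ signPow (+ q) * invFact u * toℚ (fallingProduct h (+ q) u)
A-nonneg q h u = begin
  A (+ (q ℕ.* 2)) h u
    ≡⟨ cong (λ t → signPow (+ u + t) * fact u * binom (t + h - + 1) u * binom (t - h) u) (half-nonneg q) ⟩
  signPow (+ (u ℕ.+ q)) * fact u * binom (+ q + h - + 1) u * binom (+ q - h) u
    ≡⟨ cong₂ _*_ (cong₂ _*_ (cong (_* fact u) (signPow-+ (u ℕ.+ q))) (binom≡ _ u)) (binom≡ _ u) ⟩
  toℚ σ * fact u * (toℚ X * invFact u) * (toℚ Y * invFact u)
    ≡⟨ solve 5 (λ s f x y i → s :* f :* (x :* i) :* (y :* i) := s :* (y :* x) :* i :* (f :* i))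
         refl (toℚ σ) (fact u) (toℚ X) (toℚ Y) (invFact u) ⟩
  toℚ σ * (toℚ Y * toℚ X) * invFact u * (fact u * invFact u)
    ≡⟨ cong₂ _*_ (cong (_* invFact u) (sym (toℚ-homo-*₃ σ Y X))) (fact*invFact≡1 u) ⟩
  toℚ (σ ℤ.* (Y ℤ.* X)) * invFact u * 1ℚ
    ≡⟨ ℚ.*-identityʳ _ ⟩
  toℚ (σ ℤ.* (Y ℤ.* X)) * invFact u
    ≡⟨ cong (λ N → toℚ N * invFact u) sign-regroup ⟩
  toℚ (-1ℤ ^ q ℤ.* fallingProduct h (+ q) u) * invFact u
    ≡⟨ signPow-scaled (+ q) u (fallingProduct h (+ q) u) ⟨
  signPow (+ q) * invFact u * toℚ (fallingProduct h (+ q) u) ∎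
  where
  open ≡-Reasoning
  open +-*-Solver
  σ X Y : ℤ
  σ = -1ℤ ^ (u ℕ.+ q)
  X = falling (+ q + h - + 1) u
  Y = falling (+ q - h) u
  regroup : ∀ a b x → a ℤ.* b ℤ.* x ≡ b ℤ.* (a ℤ.* x)
  regroup = solve-∀
  sign-regroup : σ ℤ.* (Y ℤ.* X) ≡ -1ℤ ^ q ℤ.* fallingProduct h (+ q) u
  sign-regroup = trans (cong (ℤ._* (Y ℤ.* X)) (ℤ.^-distribˡ-+-* -1ℤ u q)) (regroup (-1ℤ ^ u) (-1ℤ ^ q) (Y ℤ.* X))

A-neg : ∀ q h u →
  A -[1+ suc (q ℕ.* 2) ] h u ≡ signPow -[1+ q ] * invFact u * toℚ (fallingProduct h 0ℤ (u ℕ.+ suc q))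
A-neg q h u = begin
  A -[1+ suc (q ℕ.* 2) ] h u
    ≡⟨ cong (λ t → B (u ℕ.+ ∣ t ∣)) (half-neg q) ⟩
  B j
    ≡⟨ cong₂ _*_ (cong₂ _*_ (cong (_* (fact j * fact j * invFact u)) (signPow-+ u)) (binom≡ _ j)) (binom≡ _ j) ⟩
  toℚ σ * (fact j * fact j * invFact u) * (toℚ X * invFact j) * (toℚ Y * invFact j)
    ≡⟨ solve 6 (λ s f x y i i′ → s :* (f :* f :* i) :* (x :* i′) :* (y :* i′)
                              := s :* (y :* x) :* i :* ((f :* i′) :* (f :* i′)))
         refl (toℚ σ) (fact j) (toℚ X) (toℚ Y) (invFact u) (invFact j) ⟩
  toℚ σ * (toℚ Y * toℚ X) * invFact u * ((fact j * invFact j) * (fact j * invFact j))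
    ≡⟨ cong₂ _*_ (cong (_* invFact u) (sym (toℚ-homo-*₃ σ Y X)))
                 (cong₂ _*_ (fact*invFact≡1 j) (fact*invFact≡1 j)) ⟩
  toℚ (σ ℤ.* (Y ℤ.* X)) * invFact u * (1ℚ * 1ℚ)
    ≡⟨ ℚ.*-identityʳ _ ⟩
  toℚ (σ ℤ.* (Y ℤ.* X)) * invFact u
    ≡⟨ cong (λ N → toℚ N * invFact u) sign-regroup ⟨
  toℚ (-1ℤ ^ suc q ℤ.* fallingProduct h 0ℤ j) * invFact u
    ≡⟨ signPow-scaled -[1+ q ] u (fallingProduct h 0ℤ j) ⟨
  signPow -[1+ q ] * invFact u * toℚ (fallingProduct h 0ℤ j) ∎
  where
  open ≡-Reasoning
  open +-*-Solver
  B : ℕ → ℚ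
  B j = signPow (+ u) * (fact j * fact j * invFact u) * binom (h - + 1) j * binom (ℤ.- h) j
  j : ℕ
  j = u ℕ.+ suc q
  σ τ X Y : ℤ
  σ = -1ℤ ^ u
  τ = -1ℤ ^ suc q
  X = falling (h - + 1) j
  Y = falling (ℤ.- h) j
  lemma₁ : ∀ h → 0ℤ - h ≡ ℤ.- h
  lemma₁ = solve-∀
  lemma₂ : ∀ h → 0ℤ + h - + 1 ≡ h - + 1
  lemma₂ = solve-∀
  lemma₃ : ∀ a b x → a ℤ.* (b ℤ.* a ℤ.* x) ≡ a ℤ.* a ℤ.* (b ℤ.* x)
  lemma₃ = solve-∀
  sign-regroup : τ ℤ.* fallingProduct h 0ℤ j ≡ σ ℤ.* (Y ℤ.* X)
  sign-regroup = begin
    τ ℤ.* (-1ℤ ^ j ℤ.* (falling (0ℤ - h) j ℤ.* falling (0ℤ + h - + 1) j))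
      ≡⟨ cong₂ (λ s x → τ ℤ.* (s ℤ.* x)) (ℤ.^-distribˡ-+-* -1ℤ u (suc q))
           (cong₂ ℤ._*_ (cong (λ y → falling y j) (lemma₁ h)) (cong (λ y → falling y j) (lemma₂ h))) ⟩
    τ ℤ.* (σ ℤ.* τ ℤ.* (Y ℤ.* X))
      ≡⟨ lemma₃ τ σ (Y ℤ.* X) ⟩
    τ ℤ.* τ ℤ.* (σ ℤ.* (Y ℤ.* X))
      ≡⟨ cong (ℤ._* (σ ℤ.* (Y ℤ.* X))) (-1^n*-1^n≡1 (suc q)) ⟩
    1ℤ ℤ.* (σ ℤ.* (Y ℤ.* X))
      ≡⟨ ℤ.*-identityˡ _ ⟩
    σ ℤ.* (Y ℤ.* X) ∎

u!∣fallingProduct : ∀ h c {u j} → u ℕ.≤ j → + (u !) Signed.∣ fallingProduct h c j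
u!∣fallingProduct h c {u} {j} u≤j = Signed.∣-trans (Signed.∣ᵤ⇒∣ (m≤n⇒m!∣n! u≤j))
  (Signed.∣n⇒∣m*n (-1ℤ ^ j) (Signed.∣m⇒∣m*n (falling (c + h - + 1) j) (n!∣falling j (c - h))))

signPow-scaled-integral : ∀ t u N → + (u !) Signed.∣ N →
  ∃ λ (m : ℤ) → signPow t * invFact u * toℚ N ≡ m / 1
signPow-scaled-integral t u _ (Signed.divides m refl) = σ ℤ.* m , (begin
  signPow t * invFact u * toℚ (m ℤ.* + (u !))
    ≡⟨ signPow-scaled t u (m ℤ.* + (u !)) ⟩
  toℚ (σ ℤ.* (m ℤ.* + (u !))) * invFact u
    ≡⟨ cong (λ x → toℚ x * invFact u) (ℤ.*-assoc σ m (+ (u !))) ⟨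
  toℚ (σ ℤ.* m ℤ.* + (u !)) * invFact u
    ≡⟨ cong (_* invFact u) (toℚ-homo-* (σ ℤ.* m) (+ (u !))) ⟩
  toℚ (σ ℤ.* m) * fact u * invFact u
    ≡⟨ ℚ.*-assoc (toℚ (σ ℤ.* m)) (fact u) (invFact u) ⟩
  toℚ (σ ℤ.* m) * (fact u * invFact u)
    ≡⟨ cong (toℚ (σ ℤ.* m) *_) (fact*invFact≡1 u) ⟩
  toℚ (σ ℤ.* m) * 1ℚ
    ≡⟨ ℚ.*-identityʳ (toℚ (σ ℤ.* m)) ⟩
  toℚ (σ ℤ.* m) ∎)
  where
  open ≡-Reasoning
  σ : ℤ
  σ = -1ℤ ^ ∣ t ∣

signPow-scaled-≢0⇔ : ∀ t u N → (signPow t * invFact u * toℚ N ≢ 0ℚ) ⇔ (N ≢ 0ℤ)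
signPow-scaled-≢0⇔ t u N = mk⇔
  (λ ≢0 N≡0 → ≢0 (trans (cong (λ n → signPow t * invFact u * toℚ n) N≡0)
                          (ℚ.*-zeroʳ (signPow t * invFact u))))
  (λ N≢0 ≡0 → [ -1^n≢0 ∣ t ∣ , N≢0 ]′
     (ℤ.i*j≡0⇒i≡0∨j≡0 (-1ℤ ^ ∣ t ∣) (toℚ-*-invFact-≡0 _ u (trans (sym (signPow-scaled t u N)) ≡0))))

fallingProduct-≢0⇔ : ∀ h c j →
  (fallingProduct h c j ≢ 0ℤ) ⇔ (falling (c - h) j ≢ 0ℤ × falling (c + h - + 1) j ≢ 0ℤ)
fallingProduct-≢0⇔ h c j = *-≢0⇔ (falling (c - h) j) (falling (c + h - + 1) j)
  ⇔-∘ (mk⇔ proj₂ (-1^n≢0 j ,_)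
  ⇔-∘ *-≢0⇔ (-1ℤ ^ j) (falling (c - h) j ℤ.* falling (c + h - + 1) j))

product-form-integral : ∀ {x} t u h c {j} → u ℕ.≤ j →
  x ≡ signPow t * invFact u * toℚ (fallingProduct h c j) → ∃ λ (m : ℤ) → x ≡ m / 1
product-form-integral t u h c u≤j refl = signPow-scaled-integral t u _ (u!∣fallingProduct h c u≤j)

product-form-≢0⇔ : ∀ {x} t u h c j → x ≡ signPow t * invFact u * toℚ (fallingProduct h c j) →
  (x ≢ 0ℚ) ⇔ (falling (c - h) j ≢ 0ℤ × falling (c + h - + 1) j ≢ 0ℤ)
product-form-≢0⇔ t u h c j refl = fallingProduct-≢0⇔ h c j ⇔-∘ signPow-scaled-≢0⇔ t u _

productFormula : ℤ → ℕ → ℤ → ℚ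
productFormula t u h = signPow t * invFact u * prodRange (t + + 1 - + u) (t ⊔ + 0) (factorTerm h)

productFormula-reflect : ∀ {t u} (f : ℤ → ℚ) → (∀ h → f h ≡ productFormula t u h) →
  ∀ h → f (+ 1 - h) ≡ f h
productFormula-reflect {t} {u} f f≡ h = begin
  f (+ 1 - h)
    ≡⟨ f≡ (+ 1 - h) ⟩
  productFormula t u (+ 1 - h)
    ≡⟨ cong (signPow t * invFact u *_) (prodRange-factorTerm-reflect h (t + + 1 - + u) (t ⊔ + 0)) ⟩
  productFormula t u h
    ≡⟨ f≡ h ⟨
  f h ∎
  where open ≡-Reasoning

A-nonneg-prodRange : ∀ {t} q u → t ≡ + q → ∀ h → A (+ (q ℕ.* 2)) h u ≡ productFormula t u h
A-nonneg-prodRange q u refl h = begin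
  A (+ (q ℕ.* 2)) h u
    ≡⟨ A-nonneg q h u ⟩
  signPow (+ q) * invFact u * toℚ (fallingProduct h (+ q) u)
    ≡⟨ cong (signPow (+ q) * invFact u *_) (prodRange-factorTerm h (+ q) u) ⟨
  signPow (+ q) * invFact u * prodRange (+ q + + 1 - + u) (+ q) (factorTerm h)
    ≡⟨ cong (λ b → signPow (+ q) * invFact u * prodRange (+ q + + 1 - + u) (+ b) (factorTerm h))
            (ℕ.⊔-identityʳ q) ⟨
  signPow (+ q) * invFact u * prodRange (+ q + + 1 - + u) (+ q ⊔ + 0) (factorTerm h) ∎
  where open ≡-Reasoning

A-neg-prodRange : ∀ {t} q u → t ≡ -[1+ q ] → ∀ h → A -[1+ suc (q ℕ.* 2) ] h u ≡ productFormula t u h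
A-neg-prodRange q u refl h = begin
  A -[1+ suc (q ℕ.* 2) ] h u
    ≡⟨ A-neg q h u ⟩
  signPow -[1+ q ] * invFact u * toℚ (fallingProduct h 0ℤ (u ℕ.+ suc q))
    ≡⟨ cong (signPow -[1+ q ] * invFact u *_) (prodRange-factorTerm h 0ℤ (u ℕ.+ suc q)) ⟨
  signPow -[1+ q ] * invFact u * prodRange (0ℤ + + 1 - + (u ℕ.+ suc q)) 0ℤ (factorTerm h)
    ≡⟨ cong (λ a → signPow -[1+ q ] * invFact u * prodRange a 0ℤ (factorTerm h)) (lemma (+ suc q) (+ u)) ⟨
  signPow -[1+ q ] * invFact u * prodRange (-[1+ q ] + + 1 - + u) (-[1+ q ] ⊔ + 0) (factorTerm h) ∎
  where
  open ≡-Reasoning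
  lemma : ∀ s u → ℤ.- s + + 1 - u ≡ 0ℤ + + 1 - (u + s)
  lemma = solve-∀

-- Nonvanishing

hstar-elim : ∀ (P : ℤ → ℚ → Set) (f : ℤ → ℚ) → (∀ h → f (+ 1 - h) ≡ f h) →
  (∀ p → P (+ p) (f (+ suc p))) → ∀ h → P (hstar h) (f h)
hstar-elim P f f-reflect P⁺ (+ suc p) = P⁺ p
hstar-elim P f f-reflect P⁺ (+ zero) = subst (P (+ 0)) (f-reflect (+ 0)) (P⁺ 0)
hstar-elim P f f-reflect P⁺ -[1+ n ] = subst (P (+ suc n)) (f-reflect -[1+ n ]) (P⁺ (suc n))

[c+1+p]-1≡c+p : ∀ c p → c + + suc p - + 1 ≡ c + + p
[c+1+p]-1≡c+p c p = lemma c (+ p)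
  where
  lemma : ∀ c p → c + (+ 1 + p) - + 1 ≡ c + p
  lemma = solve-∀

falling-top-≢0⇔ : ∀ c p u → 0ℤ ≤ c + + p → (falling (c + + suc p - + 1) u ≢ 0ℤ) ⇔ (+ u ≤ c + + p)
falling-top-≢0⇔ c p u 0≤c+p rewrite [c+1+p]-1≡c+p c p = falling-nonneg-≢0⇔ u 0≤c+p

nonneg-interior-≢0⇔ : ∀ {q p} u → p ℕ.< q →
  (falling (+ q - + suc p) u ≢ 0ℤ × falling (+ q + + suc p - + 1) u ≢ 0ℤ) ⇔ (+ u ≤ + q - + 1 - + p)
nonneg-interior-≢0⇔ {q} {p} u p<q = mk⇔
  (λ ≢0 → subst (+ u ≤_) (sym bound≡) (to (falling-nonneg-≢0⇔ u 0≤bottom) (proj₁ ≢0)))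
  (λ u≤bound → let u≤bottom = subst (+ u ≤_) bound≡ u≤bound in
     from (falling-nonneg-≢0⇔ u 0≤bottom) u≤bottom ,
     from (falling-top-≢0⇔ (+ q) p u (+≤+ ℕ.z≤n)) (ℤ.≤-trans u≤bottom bottom≤top))
  where
  0≤bottom : 0ℤ ≤ + q - + suc p
  0≤bottom = ℤ.i≤j⇒0≤j-i (+≤+ p<q)
  bottom≤top : + q - + suc p ≤ + q + + p
  bottom≤top = ℤ.≤-trans (ℤ.i-j≤i (+ q) (+ suc p)) (ℤ.i≤i+j (+ q) (+ p))
  lemma : ∀ q p → q - + 1 - p ≡ q - (+ 1 + p)
  lemma = solve-∀
  bound≡ : + q - + 1 - + p ≡ + q - + suc p
  bound≡ = lemma (+ q) (+ p)

nonneg-exterior-≢0⇔ : ∀ {q p} u → q ℕ.≤ p →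
  (falling (+ q - + suc p) u ≢ 0ℤ × falling (+ q + + suc p - + 1) u ≢ 0ℤ) ⇔ (+ u ≤ + q + + p)
nonneg-exterior-≢0⇔ {q} {p} u q≤p = mk⇔
  (λ ≢0 → to top⇔ (proj₂ ≢0))
  (λ u≤top → falling-neg-≢0 u bottom<0 , from top⇔ u≤top)
  where
  top⇔ : (falling (+ q + + suc p - + 1) u ≢ 0ℤ) ⇔ (+ u ≤ + q + + p)
  top⇔ = falling-top-≢0⇔ (+ q) p u (+≤+ ℕ.z≤n)
  bottom<0 : + q - + suc p < 0ℤ
  bottom<0 = subst (+ q - + suc p <_) (ℤ.n⊖n≡0 q) (ℤ.⊖-monoʳ->-< q (s≤s q≤p))

neg-≢0⇔ : ∀ {q p} u → let j = u ℕ.+ suc q in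
  (falling (0ℤ - + suc p) j ≢ 0ℤ × falling (0ℤ + + suc p - + 1) j ≢ 0ℤ) ⇔ (+ u ≤ -[1+ q ] + + p)
neg-≢0⇔ {q} {p} u = mk⇔
  (λ ≢0 → subst (+ u ≤_) (ℤ.+-comm (+ p) -[1+ q ]) (to shift⇔ (to top⇔ (proj₂ ≢0))))
  (λ u≤bound → falling-neg-≢0 j -<+ ,
     from top⇔ (from shift⇔ (subst (+ u ≤_) (ℤ.+-comm -[1+ q ] (+ p)) u≤bound)))
  where
  j : ℕ
  j = u ℕ.+ suc q
  top⇔ : (falling (0ℤ + + suc p - + 1) j ≢ 0ℤ) ⇔ (+ j ≤ + p)
  top⇔ = falling-top-≢0⇔ 0ℤ p j (+≤+ ℕ.z≤n)
  shift⇔ : (+ u + + suc q ≤ + p) ⇔ (+ u ≤ + p - + suc q)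
  shift⇔ = +-≤⇔≤- (+ u) (+ suc q) (+ p)

Nonvanishing : ℤ → ℕ → ℤ → ℚ → Set
Nonvanishing t u s x = (s < t → (x ≢ 0ℚ) ⇔ (+ 0 ≤ + u × + u ≤ t - + 1 - s))
                     × (t ≤ s → (x ≢ 0ℚ) ⇔ (+ 0 ≤ + u × + u ≤ t + s))

A-nonneg-nonvanishing : ∀ {t} q u → t ≡ + q →
  ∀ p → Nonvanishing t u (+ p) (A (+ (q ℕ.* 2)) (+ suc p) u)
A-nonneg-nonvanishing q u refl p =
    (λ p<q → +0≤+u×-⇔ (nonneg-interior-≢0⇔ u (ℤ.drop‿+<+ p<q) ⇔-∘ ≢0⇔))
  , (λ q≤p → +0≤+u×-⇔ (nonneg-exterior-≢0⇔ u (ℤ.drop‿+≤+ q≤p) ⇔-∘ ≢0⇔))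
  where
  ≢0⇔ : (A (+ (q ℕ.* 2)) (+ suc p) u ≢ 0ℚ)
      ⇔ (falling (+ q - + suc p) u ≢ 0ℤ × falling (+ q + + suc p - + 1) u ≢ 0ℤ)
  ≢0⇔ = product-form-≢0⇔ (+ q) u (+ suc p) (+ q) u (A-nonneg q (+ suc p) u)

A-neg-nonvanishing : ∀ {t} q u → t ≡ -[1+ q ] →
  ∀ p → Nonvanishing t u (+ p) (A -[1+ suc (q ℕ.* 2) ] (+ suc p) u)
A-neg-nonvanishing q u refl p = (λ ()) , (λ _ → +0≤+u×-⇔ (neg-≢0⇔ u ⇔-∘ ≢0⇔))
  where
  j : ℕ
  j = u ℕ.+ suc q
  ≢0⇔ : (A -[1+ suc (q ℕ.* 2) ] (+ suc p) u ≢ 0ℚ)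
      ⇔ (falling (0ℤ - + suc p) j ≢ 0ℤ × falling (0ℤ + + suc p - + 1) j ≢ 0ℤ)
  ≢0⇔ = product-form-≢0⇔ -[1+ q ] u (+ suc p) 0ℤ j (A-neg q (+ suc p) u)

proposition4p6 : (k h : ℤ) (u : ℕ) → (+ 2) ∣ k →
    (∃ λ (m : ℤ) → A k h u ≡ m / 1)
    × (A k (+ 1 - h) u ≡ A k h u)
    × (A k h u ≡ signPow (half k) * invFact u
                   * prodRange (half k + + 1 - + u) (half k ⊔ + 0) (factorTerm h))
    × (hstar h < half k →
         (A k h u ≢ 0ℚ) ⇔ (+ 0 ≤ + u × + u ≤ half k - + 1 - hstar h))
    × (half k ≤ hstar h →
         (A k h u ≢ 0ℚ) ⇔ (+ 0 ≤ + u × + u ≤ half k + hstar h))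
proposition4p6 k@(+ .(q ℕ.* 2)) h u (divides q refl) =
    product-form-integral (+ q) u h (+ q) ℕ.≤-refl (A-nonneg q h u)
  , A-reflect h
  , product-form h
  , hstar-elim (Nonvanishing (half k) u) (λ h → A k h u) A-reflect (A-nonneg-nonvanishing q u (half-nonneg q)) h
  where
  product-form : ∀ h → A k h u ≡ productFormula (half k) u h
  product-form = A-nonneg-prodRange q u (half-nonneg q)
  A-reflect : ∀ h → A k (+ 1 - h) u ≡ A k h u
  A-reflect = productFormula-reflect {half k} {u} (λ h → A k h u) product-form
proposition4p6 k@(-[1+ .(suc (q ℕ.* 2)) ]) h u (divides (suc q) refl) =
    product-form-integral -[1+ q ] u h 0ℤ (ℕ.m≤m+n u (suc q)) (A-neg q h u)
  , A-reflect h
  , product-form h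
  , hstar-elim (Nonvanishing (half k) u) (λ h → A k h u) A-reflect (A-neg-nonvanishing q u (half-neg q)) h
  where
  product-form : ∀ h → A k h u ≡ productFormula (half k) u h
  product-form = A-neg-prodRange q u (half-neg q)
  A-reflect : ∀ h → A k (+ 1 - h) u ≡ A k h u
  A-reflect = productFormula-reflect {half k} {u} (λ h → A k h u) product-form
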